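{- Let $\Gamma$ be a typing environment, $\nabla$ a partial function from table identifiers to product types, $\widetilde{\mathit{TB}}=\mathit{TB}_1,\dots,\mathit{TB}_n$ a list of tables with $\Gamma,\nabla\vdash\mathit{TB}_j\triangleright\tau_j$ for $j=1,\dots,n$, and $\langle l_i::(I_i,R_i)\rangle_i$ a list of localized tables such that $\Gamma,\nabla\vdash_{C}(I_k,R_k)$ holds for each $(I_k,R_k)$ in the list. Then, whenever $\otimes_{\mathrm{sk}}(\widetilde{\mathit{TB}},\langle l_i::(I_i,R_i)\rangle_i)$ is defined, it equals $\mathit{flatten}_{\mathrm{s}}(\tau_1\times\dots\times\tau_n)$.
   Context: Types: $\tau_d::=\mathit{Int}\mid\mathit{String}\mid\mathit{Loc}\mid\mathit{Id}$; $\tau_m::=\{\tau_d\}\mid\tau_d$; product types $\tau_m^1\times\dots\times\tau_m^n$. An interface is $I=(\mathit{tid},\mathit{sk})$ with identifier $I.\mathit{tid}$ a table identifier or the special symbol $\bot$ and schema $I.\mathit{sk}$ a product type; a data set $R$ is a finite multiset of tuples whose components are constant values (integers, strings, table identifiers, localities, multisets thereof). Tables: $\mathit{TB}::=\mathit{tid}@\ell\mid\mathit{tbv}\mid(I,R)$, where $\ell$ is a locality $l$ or a locality variable $u$ and $\mathit{tbv}$ a table variable. A localized table $l::(I,R)$ pairs a locality with a table. Typing: a typing environment $\Gamma$ is a finite sequence of bindings of variables to types (table variables to product types), at most one per variable. Expression/tuple typing: $\Gamma\vdash u\triangleright\mathit{Loc}$ if $\Gamma(u)=\mathit{Loc}$,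 $\Gamma\vdash l\triangleright\mathit{Loc}$, $\mathit{num}\triangleright\mathit{Int}$, $\mathit{str}\triangleright\mathit{String}$, $\mathit{tid}\triangleright\mathit{Id}$, a multiset of elements of type $\tau_d$ has type $\{\tau_d\}$, and a tuple $e_1,\dots,e_n$ has type $\tau_1\times\dots\times\tau_n$ if each $e_i$ has type $\tau_i$. Table typing: $\Gamma,\nabla\vdash\mathit{tid}@\ell\triangleright\nabla(\mathit{tid})$ if $\mathit{tid}\in\mathrm{dom}(\nabla)$ and $\Gamma\vdash\ell\triangleright\mathit{Loc}$; $\Gamma,\nabla\vdash\mathit{tbv}\triangleright\Gamma(\mathit{tbv})$ if $\mathit{tbv}\in\mathrm{dom}(\Gamma)$; $\Gamma,\nabla\vdash(I,R)\triangleright I.\mathit{sk}$ if $\Gamma\vdash t\triangleright I.\mathit{sk}$ for all $t\in R$ and ($I.\mathit{tid}\neq\bot\Rightarrow\nabla(I.\mathit{tid})=I.\mathit{sk}$). Component typing: $\Gamma,\nabla\vdash_C(I,R)$ holds iff $\Gamma\vdash t\triangleright I.\mathit{sk}$ for all $t\in R$ and $\nabla(I.\mathit{tid})=I.\mathit{sk}$. $\mathit{flatten}_{\mathrm{s}}((\tau^{11}\times\dots\times\tau^{1n_1})\times\dots\times(\tau^{k1}\times\dots\times\tau^{kn_k}))=\tau^{11}\times\dots\times\tau^{1n_1}\times\dots\times\tau^{k1}\times\dots\times\tau^{kn_k}$. $\otimes_{\mathrm{sk}}(\widetilde{\mathit{TB}},\langle l_i::(I_i,R_i)\rangle_i)$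 is undefined if either some $\mathit{TB}_j=\mathit{tid}@l$ with no $i$ satisfying $l_i=l$ and $I_i.\mathit{tid}=\mathit{tid}$, or $\widetilde{\mathit{TB}}$ contains some table variable $\mathit{tbv}$ or some $\mathit{tid}@u$ with $u$ a locality variable; otherwise it equals $\mathit{flatten}_{\mathrm{s}}(\tau'_1\times\dots\times\tau'_n)$ where $\tau'_j=I_k.\mathit{sk}$ if $\mathit{TB}_j=I_k.\mathit{tid}@l_k$ for some $k$, and $\tau'_j=I_0.\mathit{sk}$ if $\mathit{TB}_j=(I_0,R_0)$. -}

module Defs where

open import Data.Nat using (ℕ)
open import Data.Integer using (ℤ)
open import Data.String using (String)
open import Data.Maybe using (Maybe; just; nothing)
open import Data.List using (List; map; concat)
open import Data.Product using (_×_; _,_; proj₁; ∃)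
open import Data.List.Membership.Propositional using (_∈_)
open import Data.List.Relation.Unary.All using (All)
open import Data.List.Relation.Unary.Any using (Any)
open import Data.List.Relation.Binary.Pointwise using (Pointwise)
open import Data.List.Relation.Unary.Unique.Propositional using (Unique)
open import Relation.Binary.PropositionalEquality using (_≡_)

TId : Set
TId = ℕ
Loc : Set
Loc = ℕ
LVar : Set
LVar = ℕ
TbVar : Set
TbVar = ℕ

data TyD : Set where
  Int String' LocT Id : TyD

data TyM : Set where
  setOf : TyD → TyM
  base  : TyD → TyM

-- product type τ_m^1 × … × τ_m^n, as the list of its factors
ProdTy : Set
ProdTy = List TyM

flattenₛ : List ProdTy → ProdTy
flattenₛ = concat

data Var : Set where
  lvar  : LVar → Var
  tbvar : TbVar → Var
  dvar  : ℕ → Var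

data GTy : Set where
  mty : TyM → GTy
  pty : ProdTy → GTy

Env : Set
Env = List (Var × GTy)

WfEnv : Env → Set
WfEnv Γ = Unique (map proj₁ Γ)

TEnv : Set
TEnv = TId → Maybe ProdTy

data Const : Set where
  cint : ℤ → Const
  cstr : String → Const
  ctid : TId → Const
  cloc : Loc → Const

data Value : Set where
  vconst : Const → Value
  vset   : List Const → Value   -- a (finite) multiset of constants

Tuple : Set
Tuple = List Value

-- data set: finite multiset of tuples
DataSet : Set
DataSet = List Tuple

-- interface I = (tid, sk); tid = nothing encodes ⊥
record Interface : Set where
  constructor iface
  field
    tid : Maybe TId
    sk  : ProdTy
open Interface public

data LocE : Set where
  locL : Loc → LocE
  locU : LVar → LocE

data Table : Set where
  _at_  : TId → LocE → Table
  tbv   : TbVar → Table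
  tbl   : Interface → DataSet → Table

LTable : Set
LTable = Loc × Interface × DataSet

data ⊢c_▷_ : Const → TyD → Set where
  t-int : ∀ {n} → ⊢c cint n ▷ Int
  t-str : ∀ {s} → ⊢c cstr s ▷ String'
  t-tid : ∀ {t} → ⊢c ctid t ▷ Id
  t-loc : ∀ {l} → ⊢c cloc l ▷ LocT

data _⊢v_▷_ (Γ : Env) : Value → TyM → Set where
  t-const : ∀ {c τ} → ⊢c c ▷ τ → Γ ⊢v vconst c ▷ base τ
  t-set   : ∀ {cs τ} → All (λ c → ⊢c c ▷ τ) cs → Γ ⊢v vset cs ▷ setOf τ

_⊢t_▷_ : Env → Tuple → ProdTy → Set
Γ ⊢t t ▷ τ = Pointwise (Γ ⊢v_▷_) t τ

data _⊢ℓ_▷Loc (Γ : Env) : LocE → Set where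
  t-l : ∀ {l} → Γ ⊢ℓ locL l ▷Loc
  t-u : ∀ {u} → (lvar u , mty (base LocT)) ∈ Γ → Γ ⊢ℓ locU u ▷Loc

data _,_⊢T_▷_ (Γ : Env) (∇ : TEnv) : Table → ProdTy → Set where
  t-tidat : ∀ {t ℓ τ} → ∇ t ≡ just τ → Γ ⊢ℓ ℓ ▷Loc → Γ , ∇ ⊢T (t at ℓ) ▷ τ
  t-tbv   : ∀ {x τ} → (tbvar x , pty τ) ∈ Γ → Γ , ∇ ⊢T tbv x ▷ τ
  t-tbl   : ∀ {I R} → All (λ t → Γ ⊢t t ▷ sk I) R
          → (∀ {t} → tid I ≡ just t → ∇ t ≡ just (sk I))
          → Γ , ∇ ⊢T tbl I R ▷ sk I

-- Component typing  Γ,∇ ⊢_C (I , R)  (∇(I.tid) defined, hence I.tid ≠ ⊥)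
_,_⊢C_ : Env → TEnv → Interface × DataSet → Set
Γ , ∇ ⊢C (I , R) =
  All (λ t → Γ ⊢t t ▷ sk I) R × ∃ λ t → tid I ≡ just t × ∇ t ≡ just (sk I)

-- ⊗_sk as a relation: OtimesSk TBs L σ  means  ⊗_sk(TBs, L) is defined
-- (for some admissible choice of the index k) and equals σ.

data SkOf (L : List LTable) : Table → ProdTy → Set where
  sk-at  : ∀ {t l k} → k ∈ L → proj₁ k ≡ l → tid (proj₁ (Data.Product.proj₂ k)) ≡ just t
         → SkOf L (t at locL l) (sk (proj₁ (Data.Product.proj₂ k)))
  sk-tbl : ∀ {I R} → SkOf L (tbl I R) (sk I)

OtimesSk : List Table → List LTable → ProdTy → Set
OtimesSk TBs L σ = ∃ λ τs → Pointwise (SkOf L) TBs τs × σ ≡ flattenₛ τs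

-- The schema ⊗_sk assigns to each table is the type the table typing assigns to it:
-- for (I, R) both are I.sk, and for tid@l the chosen localized table has identifier tid,
-- so its schema is ∇(tid) by component typing, which is the type of tid@l.
module Submission where

open import Defs
open import Data.List using (List; _∷_)
open import Data.Product using (proj₂; _,_)
open import Data.Maybe.Properties using (just-injective)
open import Data.List.Relation.Unary.All as All using (All)
open import Data.List.Relation.Binary.Pointwise using (Pointwise; []; _∷_)
open import Relation.Binary.PropositionalEquality using (_≡_; refl; sym; trans; cong; cong₂)

WellTypedComponents : Env → TEnv → List LTable → Set
WellTypedComponents Γ ∇ = All (λ lt → Γ , ∇ ⊢C proj₂ lt)

skOf-unique : ∀ {Γ ∇ L TB τ τ′} → WellTypedComponents Γ ∇ L
            → Γ , ∇ ⊢T TB ▷ τ → SkOf L TB τ′ → τ′ ≡ τ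
skOf-unique comps (t-tidat ∇t≡τ _) (sk-at k∈L refl tidI≡t)
  with All.lookup comps k∈L
... | _ , t′ , tidI≡t′ , ∇t′≡skI with trans (sym tidI≡t) tidI≡t′
... | refl = just-injective (trans (sym ∇t′≡skI) ∇t≡τ)
skOf-unique comps (t-tbl _ _) sk-tbl = refl

skOfs-unique : ∀ {Γ ∇ L TBs τs τs′} → WellTypedComponents Γ ∇ L
             → Pointwise (λ TB τ → Γ , ∇ ⊢T TB ▷ τ) TBs τs
             → Pointwise (SkOf L) TBs τs′ → τs′ ≡ τs
skOfs-unique comps []         []           = refl
skOfs-unique comps (ty ∷ tys) (sk ∷ sks) =
  cong₂ _∷_ (skOf-unique comps ty sk) (skOfs-unique comps tys sks)

lemmaB12 : (Γ : Env) → WfEnv Γ → (∇ : TEnv)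
         → (TBs : List Table) (τs : List ProdTy)
         → Pointwise (λ TB τ → Γ , ∇ ⊢T TB ▷ τ) TBs τs
         → (L : List LTable)
         → All (λ lt → Γ , ∇ ⊢C proj₂ lt) L
         → (σ : ProdTy) → OtimesSk TBs L σ
         → σ ≡ flattenₛ τs
lemmaB12 Γ _ ∇ TBs τs tys L comps σ (τs′ , sks , σ≡flat) =
  trans σ≡flat (cong flattenₛ (skOfs-unique comps tys sks))
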